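{- Every language in P is rankable if and only if every language in P whose census function is computable in polynomial time is rankable.
   Context: Strings are over $\Sigma=\{0,1\}$, with $\le$ the standard lexicographic order on $\Sigma^*$. The census function of $A$ is $\mathrm{census}_A(1^n)=|\{x\in A:|x|=n\}|$. The ranking function of $A$ maps $x$ to $|\{y\le x: y\in A\}|$; $A$ is rankable if its ranking function is polynomial-time computable. -}

module Defs where

open import Data.Bool using (Bool; true; false; if_then_else_; _∧_; _∨_)
open import Data.Nat using (ℕ; zero; suc; _+_; _^_; _<ᵇ_; _≡ᵇ_)
open import Data.Nat.Binary using (ℕᵇ; 2[1+_]; 1+[2_]) renaming (zero to zeroᵇ; fromℕ to toℕᵇ)
open import Data.Fin using (Fin) renaming (zero to fz; suc to fs)
open import Data.Fin using (_≟_)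
open import Data.List using (List; []; _∷_; length; filterᵇ; map; concatMap; upTo; replicate; _++_)
open import Data.Product using (Σ; _×_; _,_)
open import Relation.Nullary using (does)
open import Relation.Binary.PropositionalEquality using (_≡_)

-- Strings over Σ = {0,1}: false = 0, true = 1.

Str : Set
Str = List Bool

Lang : Set
Lang = Str → Bool

allOfLength : ℕ → List Str
allOfLength zero    = [] ∷ []
allOfLength (suc n) = map (false ∷_) (allOfLength n) ++ map (true ∷_) (allOfLength n)

lex≤ : Str → Str → Bool
lex≤ []          _           = true
lex≤ (_ ∷ _)     []          = false
lex≤ (false ∷ x) (true ∷ y)  = true
lex≤ (true ∷ x)  (false ∷ y) = false
lex≤ (false ∷ x) (false ∷ y) = lex≤ x y
lex≤ (true ∷ x)  (true ∷ y)  = lex≤ x y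

std≤ : Str → Str → Bool
std≤ y x = (length y <ᵇ length x) ∨ ((length y ≡ᵇ length x) ∧ lex≤ y x)

census : Lang → ℕ → ℕ
census A n = length (filterᵇ A (allOfLength n))

allUpToLength : ℕ → List Str
allUpToLength n = concatMap allOfLength (upTo (suc n))

-- rank_A(x) = |{ y ≤ x : y ∈ A }|  (every y ≤ x has |y| ≤ |x|)
rank : Lang → Str → ℕ
rank A x = length (filterᵇ (λ y → std≤ y x ∧ A y) (allUpToLength (length x)))

-- Binary encoding of natural numbers (bijective base 2, least significant first)

encℕᵇ : ℕᵇ → Str
encℕᵇ zeroᵇ    = []
encℕᵇ 2[1+ b ] = true ∷ encℕᵇ b
encℕᵇ 1+[2 b ] = false ∷ encℕᵇ b

encℕ : ℕ → Str
encℕ n = encℕᵇ (toℕᵇ n)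

-- Deterministic single-tape Turing machines, two-way infinite tape.
-- Tape alphabet Fin (3 + g): symbol 0 = blank, 1 = bit 0, 2 = bit 1, rest work symbols.

data Move : Set where
  L R S : Move

record TM : Set where
  field
    nQ    : ℕ
    g     : ℕ
    start : Fin nQ
    halt  : Fin nQ
    δ     : Fin nQ → Fin (3 + g) → Fin nQ × Fin (3 + g) × Move

module _ (M : TM) where
  open TM M

  Sym : Set
  Sym = Fin (3 + g)

  blank : Sym
  blank = fz

  bitSym : Bool → Sym
  bitSym false = fs fz
  bitSym true  = fs (fs fz)

  record Config : Set where
    constructor cfg
    field
      state : Fin nQ
      left  : List Sym   -- cells left of the head, nearest first
      head  : Sym
      right : List Sym   -- cells right of the head, nearest first

  initConfig : Str → Config
  initConfig []      = cfg start [] blank []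
  initConfig (b ∷ x) = cfg start [] (bitSym b) (map bitSym x)

  move : Move → List Sym → Sym → List Sym → Config → Fin nQ → Config
  move L []      s r _ q = cfg q [] blank (s ∷ r)
  move L (a ∷ l) s r _ q = cfg q l a (s ∷ r)
  move R l s []      _ q = cfg q (s ∷ l) blank []
  move R l s (a ∷ r) _ q = cfg q (s ∷ l) a r
  move S l s r       _ q = cfg q l s r

  step : Config → Config
  step c@(cfg q l h r) with does (q ≟ halt)
  ... | true  = c
  ... | false with δ q h
  ...   | q' , s' , m = move m l s' r c q'

  run : ℕ → Config → Config
  run zero    c = c
  run (suc t) c = run t (step c)

  -- output: the maximal string of bits starting at the head cell
  readBits : List Sym → Str
  readBits []                        = []
  readBits (fz ∷ _)                  = []
  readBits (fs fz ∷ r)               = false ∷ readBits r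
  readBits (fs (fs fz) ∷ r)          = true ∷ readBits r
  readBits (fs (fs (fs _)) ∷ _)      = []

  output : Config → Str
  output (cfg _ _ h r) = readBits (h ∷ r)

  ComputesWithin : ℕ → Str → Str → Set
  ComputesWithin t x y =
    Config.state (run t (initConfig x)) ≡ halt × output (run t (initConfig x)) ≡ y

PolyTimeComputable : (Str → Str) → Set
PolyTimeComputable f =
  Σ TM λ M → Σ ℕ λ c → ∀ x → ComputesWithin M (length x ^ c + c) x (f x)

InP : Lang → Set
InP A = PolyTimeComputable (λ x → A x ∷ [])

Rankable : Lang → Set
Rankable A = PolyTimeComputable (λ x → encℕ (rank A x))

CensusPolyTime : Lang → Set
CensusPolyTime A =
  Σ TM λ M → Σ ℕ λ c → ∀ n →
    ComputesWithin M (n ^ c + c) (replicate n true) (encℕ (census A n))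

-- Given A ∈ P, let padded A accept 0ᵏ and 0ᵏ1y for y ∈ A, and let balanced A accept bu iff
-- b xor (u ∈ padded A). Exactly one of 0u, 1u lies in balanced A, so its census at length m + 1
-- is 2ᵐ, and balanced A ∈ P by skipping the leading zeros and running the decider of A.
-- Counting gives rank (balanced A) (001x) = 2^(|x|+2) + rank A x with rank A x < 2^(|x|+1);
-- in the bijective binary notation of encℕ this number is written encℕ (rank A x) followed by 1 0ʲ.
-- So A is ranked by writing 001 in front of x, running a ranker of balanced A, and erasing the
-- final digits 1 0ʲ. The converse implication is trivial.

{-# OPTIONS --safe #-}
module Submission where

open import Defs
open import Data.Bool using (Bool; true; false; if_then_else_; _∧_; not; _xor_)
open import Data.Bool.Properties using (T-≡)
open import Data.Empty using (⊥-elim)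
open import Data.Fin using (Fin; _≟_; _↑ˡ_; _↑ʳ_; splitAt) renaming (zero to fz; suc to fs)
open import Data.Fin.Properties using (splitAt-↑ˡ; splitAt-↑ʳ)
open import Data.List using (List; []; _∷_; length; filterᵇ; map; concatMap; upTo; replicate; drop; _++_; _∷ʳ_; _ʳ++_)
open import Data.List.Properties
  using (upTo-∷ʳ; concatMap-++; ++-identityʳ; length-++; length-map; length-replicate; map-++; map-replicate; map-id; ++-ʳ++)
open import Data.List.Relation.Unary.All using (All; []; _∷_)
import Data.List.Relation.Unary.All as All
open import Data.List.Relation.Unary.All.Properties using (map⁺; ++⁺; replicate⁺)
open import Data.Nat using (ℕ; zero; suc; _+_; _*_; _^_; _∸_; _<ᵇ_; _≡ᵇ_; _≤_; _<_; z≤n; s≤s; _≤?_)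
open import Data.Nat.Binary using (ℕᵇ; 2[1+_]; 1+[2_]; toℕ; fromℕ) renaming (zero to zeroᵇ)
open import Data.Nat.Binary.Properties using (fromℕ-toℕ; toℕ-fromℕ)
open import Data.Nat.DivMod using (_/_; m*n/n≡m)
open import Data.Nat.Properties hiding (_≟_)
open import Data.Nat.Solver using (module +-*-Solver)
open import Data.Product using (Σ; _×_; _,_; proj₁; proj₂)
open import Data.Sum using (_⊎_; inj₁; inj₂; [_,_]′)
open import Function using (_∘_; id)
open import Function.Bundles using (_⇔_; mk⇔; Equivalence)
open import Relation.Binary.Definitions using (tri<; tri≈; tri>)
open import Relation.Binary.PropositionalEquality
open import Relation.Nullary using (¬_; yes; no; Dec; does)
open import Relation.Nullary.Decidable using (dec-true; dec-false)
open +-*-Solver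

pattern 𝟘 = fz
pattern 𝟙 = fs fz
pattern 𝟚 = fs (fs fz)
pattern 𝟛 = fs (fs (fs fz))
pattern 𝟜 = fs (fs (fs (fs fz)))

-- Counting strings

module _ {X : Set} where

  count : (X → Bool) → List X → ℕ
  count p []       = 0
  count p (x ∷ xs) = if p x then suc (count p xs) else count p xs

  length-filterᵇ : ∀ p xs → length (filterᵇ p xs) ≡ count p xs
  length-filterᵇ p []       = refl
  length-filterᵇ p (x ∷ xs) with p x
  ... | true  = cong suc (length-filterᵇ p xs)
  ... | false = length-filterᵇ p xs

  count-++ : ∀ p xs ys → count p (xs ++ ys) ≡ count p xs + count p ys
  count-++ p []       ys = refl
  count-++ p (x ∷ xs) ys with p x
  ... | true  = cong suc (count-++ p xs ys)
  ... | false = count-++ p xs ys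

  count-cong : ∀ {p q} {xs} → All (λ x → p x ≡ q x) xs → count p xs ≡ count q xs
  count-cong [] = refl
  count-cong {q = q} {x ∷ xs} (px≡qx ∷ eqs) rewrite px≡qx with q x
  ... | true  = cong suc (count-cong eqs)
  ... | false = count-cong eqs

  count-false : ∀ xs → count (λ _ → false) xs ≡ 0
  count-false []       = refl
  count-false (_ ∷ xs) = count-false xs

  count-true : ∀ xs → count (λ _ → true) xs ≡ length xs
  count-true []       = refl
  count-true (_ ∷ xs) = cong suc (count-true xs)

  count-+-count-not : ∀ p xs → count p xs + count (not ∘ p) xs ≡ length xs
  count-+-count-not p []       = refl
  count-+-count-not p (x ∷ xs) with p x
  ... | true  = cong suc (count-+-count-not p xs)
  ... | false = trans (+-suc (count p xs) _) (cong suc (count-+-count-not p xs))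

  count-mono : ∀ {p q} → (∀ x → p x ≡ true → q x ≡ true) → ∀ xs → count p xs ≤ count q xs
  count-mono p⇒q [] = z≤n
  count-mono {p} {q} p⇒q (x ∷ xs) with p x in px | q x in qx
  ... | true  | true  = s≤s (count-mono p⇒q xs)
  ... | true  | false with () ← trans (sym (p⇒q x px)) qx
  ... | false | true  = m≤n⇒m≤1+n (count-mono p⇒q xs)
  ... | false | false = count-mono p⇒q xs

  count-≤-length : ∀ p xs → count p xs ≤ length xs
  count-≤-length p xs = ≤-trans (count-mono (λ _ _ → refl) xs) (≤-reflexive (count-true xs))

module _ {X Y : Set} where

  count-map : ∀ (p : Y → Bool) (f : X → Y) xs → count p (map f xs) ≡ count (p ∘ f) xs
  count-map p f []       = refl
  count-map p f (x ∷ xs) with p (f x)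
  ... | true  = cong suc (count-map p f xs)
  ... | false = count-map p f xs

All-length-allOfLength : ∀ k → All (λ y → length y ≡ k) (allOfLength k)
All-length-allOfLength zero    = refl ∷ []
All-length-allOfLength (suc k) =
  ++⁺ (map⁺ (All.map (cong suc) (All-length-allOfLength k)))
      (map⁺ (All.map (cong suc) (All-length-allOfLength k)))

2^[1+n]≡2^n+2^n : ∀ n → 2 ^ suc n ≡ 2 ^ n + 2 ^ n
2^[1+n]≡2^n+2^n n = cong (2 ^ n +_) (+-identityʳ (2 ^ n))

count-allOfLength-suc : ∀ p k → count p (allOfLength (suc k))
  ≡ count (p ∘ (false ∷_)) (allOfLength k) + count (p ∘ (true ∷_)) (allOfLength k)
count-allOfLength-suc p k = begin
  count p (map (false ∷_) Sₖ ++ map (true ∷_) Sₖ)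
    ≡⟨ count-++ p (map (false ∷_) Sₖ) _ ⟩
  count p (map (false ∷_) Sₖ) + count p (map (true ∷_) Sₖ)
    ≡⟨ cong₂ _+_ (count-map p (false ∷_) Sₖ) (count-map p (true ∷_) Sₖ) ⟩
  count (p ∘ (false ∷_)) Sₖ + count (p ∘ (true ∷_)) Sₖ ∎
  where open ≡-Reasoning
        Sₖ : List Str
        Sₖ = allOfLength k

count-true-allOfLength : ∀ k → count (λ _ → true) (allOfLength k) ≡ 2 ^ k
count-true-allOfLength zero    = refl
count-true-allOfLength (suc k) = begin
  count (λ _ → true) (allOfLength (suc k))         ≡⟨ count-allOfLength-suc (λ _ → true) k ⟩
  count (λ _ → true) Sₖ + count (λ _ → true) Sₖ    ≡⟨ cong (λ c → c + c) (count-true-allOfLength k) ⟩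
  2 ^ k + 2 ^ k                                    ≡⟨ 2^[1+n]≡2^n+2^n k ⟨
  2 ^ suc k ∎
  where open ≡-Reasoning
        Sₖ : List Str
        Sₖ = allOfLength k

length-allOfLength : ∀ k → length (allOfLength k) ≡ 2 ^ k
length-allOfLength k = trans (sym (count-true (allOfLength k))) (count-true-allOfLength k)

countShorter : (Str → Bool) → ℕ → ℕ
countShorter p n = count p (concatMap allOfLength (upTo n))

countShorter-suc : ∀ p n → countShorter p (suc n) ≡ countShorter p n + count p (allOfLength n)
countShorter-suc p n = begin
  count p (concatMap allOfLength (upTo (suc n)))           ≡⟨ cong (count p ∘ concatMap allOfLength) (upTo-∷ʳ n) ⟨
  count p (concatMap allOfLength (upTo n ∷ʳ n))            ≡⟨ cong (count p) (concatMap-++ allOfLength (upTo n) (n ∷ [])) ⟩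
  count p (concatMap allOfLength (upTo n) ++ allOfLength n ++ [])
    ≡⟨ count-++ p (concatMap allOfLength (upTo n)) _ ⟩
  countShorter p n + count p (allOfLength n ++ [])
    ≡⟨ cong (λ ys → countShorter p n + count p ys) (++-identityʳ (allOfLength n)) ⟩
  countShorter p n + count p (allOfLength n) ∎
  where open ≡-Reasoning

suc-countShorter-true : ∀ n → suc (countShorter (λ _ → true) n) ≡ 2 ^ n
suc-countShorter-true zero    = refl
suc-countShorter-true (suc n) = begin
  suc (countShorter T (suc n))                        ≡⟨ cong suc (countShorter-suc T n) ⟩
  suc (countShorter T n) + count T (allOfLength n)    ≡⟨ cong₂ _+_ (suc-countShorter-true n) (count-true-allOfLength n) ⟩
  2 ^ n + 2 ^ n                                       ≡⟨ 2^[1+n]≡2^n+2^n n ⟨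
  2 ^ suc n ∎
  where open ≡-Reasoning
        T : Str → Bool
        T _ = true

<ᵇ-irrefl : ∀ n → (n <ᵇ n) ≡ false
<ᵇ-irrefl zero    = refl
<ᵇ-irrefl (suc n) = <ᵇ-irrefl n

≡ᵇ-refl : ∀ n → (n ≡ᵇ n) ≡ true
≡ᵇ-refl n = Equivalence.to T-≡ (≡⇒≡ᵇ n n refl)

countShorter-std≤ : ∀ A x {m} → m ≤ length x → countShorter (λ y → std≤ y x ∧ A y) m ≡ countShorter A m
countShorter-std≤ A x {zero}  _   = refl
countShorter-std≤ A x {suc m} m<∣x∣ = begin
  countShorter P (suc m)                              ≡⟨ countShorter-suc P m ⟩
  countShorter P m + count P (allOfLength m)
    ≡⟨ cong₂ _+_ (countShorter-std≤ A x (<⇒≤ m<∣x∣)) (count-cong (All.map P≡A (All-length-allOfLength m))) ⟩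
  countShorter A m + count A (allOfLength m)          ≡⟨ countShorter-suc A m ⟨
  countShorter A (suc m) ∎
  where
  open ≡-Reasoning
  P : Str → Bool
  P y = std≤ y x ∧ A y
  P≡A : ∀ {y} → length y ≡ m → P y ≡ A y
  P≡A refl rewrite Equivalence.to T-≡ (<⇒<ᵇ m<∣x∣) = refl

rank-split : ∀ A x → rank A x ≡ countShorter A (length x) + count (λ y → lex≤ y x ∧ A y) (allOfLength (length x))
rank-split A x = begin
  rank A x                                  ≡⟨ length-filterᵇ P _ ⟩
  countShorter P (suc n)                    ≡⟨ countShorter-suc P n ⟩
  countShorter P n + count P (allOfLength n)
    ≡⟨ cong₂ _+_ (countShorter-std≤ A x ≤-refl) (count-cong (All.map P≡lex (All-length-allOfLength n))) ⟩
  countShorter A n + count (λ y → lex≤ y x ∧ A y) (allOfLength n) ∎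
  where
  open ≡-Reasoning
  n : ℕ
  n = length x
  P : Str → Bool
  P y = std≤ y x ∧ A y
  P≡lex : ∀ {y} → length y ≡ n → P y ≡ (lex≤ y x ∧ A y)
  P≡lex {y} ∣y∣≡n rewrite ∣y∣≡n | <ᵇ-irrefl n | ≡ᵇ-refl n = refl

rank-< : ∀ A x → rank A x < 2 ^ suc (length x)
rank-< A x = begin-strict
  rank A x                                            ≡⟨ rank-split A x ⟩
  countShorter A n + count Q (allOfLength n)
    ≤⟨ +-mono-≤ (count-mono (λ _ _ → refl) (concatMap allOfLength (upTo n))) (count-≤-length Q (allOfLength n)) ⟩
  countShorter (λ _ → true) n + length (allOfLength n)
    <⟨ +-mono-≤ (≤-reflexive (suc-countShorter-true n)) (≤-reflexive (length-allOfLength n)) ⟩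
  2 ^ n + 2 ^ n                                       ≡⟨ 2^[1+n]≡2^n+2^n n ⟨
  2 ^ suc n ∎
  where open ≤-Reasoning
        n : ℕ
        n = length x
        Q : Str → Bool
        Q y = lex≤ y x ∧ A y

-- The balanced language

padded : Lang → Lang
padded A []          = true
padded A (false ∷ u) = padded A u
padded A (true ∷ y)  = A y

balanced : Lang → Lang
balanced A []      = false
balanced A (b ∷ u) = b xor padded A u

2^[1+n]/2≡2^n : ∀ n → 2 ^ suc n / 2 ≡ 2 ^ n
2^[1+n]/2≡2^n n = trans (cong (_/ 2) (*-comm 2 (2 ^ n))) (m*n/n≡m (2 ^ n) 2)

module _ (A : Lang) where

  census-balanced-suc : ∀ m → census (balanced A) (suc m) ≡ 2 ^ m
  census-balanced-suc m = begin
    census (balanced A) (suc m)                                 ≡⟨ length-filterᵇ (balanced A) (allOfLength (suc m)) ⟩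
    count (balanced A) (allOfLength (suc m))                    ≡⟨ count-allOfLength-suc (balanced A) m ⟩
    count (padded A) Sₘ + count (not ∘ padded A) Sₘ             ≡⟨ count-+-count-not (padded A) Sₘ ⟩
    length Sₘ                                                   ≡⟨ length-allOfLength m ⟩
    2 ^ m ∎
    where open ≡-Reasoning
          Sₘ : List Str
          Sₘ = allOfLength m

  census-balanced : ∀ N → census (balanced A) N ≡ 2 ^ N / 2
  census-balanced zero    = refl
  census-balanced (suc m) = trans (census-balanced-suc m) (sym (2^[1+n]/2≡2^n m))

  suc-countShorter-balanced : ∀ m → suc (countShorter (balanced A) (suc m)) ≡ 2 ^ m
  suc-countShorter-balanced zero    = refl
  suc-countShorter-balanced (suc m) = begin
    suc (countShorter (balanced A) (2 + m))                                    ≡⟨ cong suc (countShorter-suc (balanced A) (suc m)) ⟩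
    suc (countShorter (balanced A) (suc m)) + count (balanced A) (allOfLength (suc m))
      ≡⟨ cong₂ _+_ (suc-countShorter-balanced m)
                   (trans (sym (length-filterᵇ (balanced A) (allOfLength (suc m)))) (census-balanced-suc m)) ⟩
    2 ^ m + 2 ^ m                                                              ≡⟨ 2^[1+n]≡2^n+2^n m ⟨
    2 ^ suc m ∎
    where open ≡-Reasoning

  count-padded : ∀ n → count (padded A) (allOfLength n) ≡ suc (countShorter A n)
  count-padded zero    = refl
  count-padded (suc n) = begin
    count (padded A) (allOfLength (suc n))                  ≡⟨ count-allOfLength-suc (padded A) n ⟩
    count (padded A) (allOfLength n) + count A (allOfLength n)  ≡⟨ cong (_+ count A (allOfLength n)) (count-padded n) ⟩
    suc (countShorter A n + count A (allOfLength n))        ≡⟨ cong suc (countShorter-suc A n) ⟨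
    suc (countShorter A (suc n)) ∎
    where open ≡-Reasoning

  rank-balanced : ∀ x → rank (balanced A) (false ∷ false ∷ true ∷ x) ≡ 2 ^ (2 + length x) + rank A x
  rank-balanced x = begin
    rank B z                                                      ≡⟨ rank-split B z ⟩
    countShorter B (3 + n) + count (λ y → lex≤ y z ∧ B y) (allOfLength (3 + n))
      ≡⟨ cong (countShorter B (3 + n) +_) below-z ⟩
    countShorter B (3 + n) + (suc (countShorter A n) + sameLength)   ≡⟨ +-suc (countShorter B (3 + n)) _ ⟩
    suc (countShorter B (3 + n)) + (countShorter A n + sameLength)
      ≡⟨ cong₂ _+_ (suc-countShorter-balanced (2 + n)) (sym (rank-split A x)) ⟩
    2 ^ (2 + n) + rank A x ∎
    where
    open ≡-Reasoning
    B : Lang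
    B = balanced A
    z : Str
    z = false ∷ false ∷ true ∷ x
    n : ℕ
    n = length x
    sameLength : ℕ
    sameLength = count (λ y → lex≤ y x ∧ A y) (allOfLength n)
    +-count-false : ∀ p k → count p (allOfLength k) + count (λ _ → false) (allOfLength k) ≡ count p (allOfLength k)
    +-count-false p k = trans (cong (count p (allOfLength k) +_) (count-false (allOfLength k))) (+-identityʳ _)
    below-z : count (λ y → lex≤ y z ∧ B y) (allOfLength (3 + n)) ≡ suc (countShorter A n) + sameLength
    below-z = begin
      count (λ y → lex≤ y z ∧ B y) (allOfLength (3 + n))
        ≡⟨ trans (count-allOfLength-suc _ (2 + n)) (+-count-false _ (2 + n)) ⟩
      count (λ u → lex≤ u (false ∷ true ∷ x) ∧ padded A u) (allOfLength (2 + n))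
        ≡⟨ trans (count-allOfLength-suc _ (1 + n)) (+-count-false _ (1 + n)) ⟩
      count (λ v → lex≤ v (true ∷ x) ∧ padded A v) (allOfLength (1 + n))
        ≡⟨ count-allOfLength-suc _ n ⟩
      count (padded A) (allOfLength n) + sameLength    ≡⟨ cong (_+ sameLength) (count-padded n) ⟩
      suc (countShorter A n) + sameLength ∎

-- Bijective binary numerals

decode : Str → ℕᵇ
decode []          = zeroᵇ
decode (false ∷ d) = 1+[2 decode d ]
decode (true ∷ d)  = 2[1+ decode d ]

encℕᵇ-decode : ∀ d → encℕᵇ (decode d) ≡ d
encℕᵇ-decode []          = refl
encℕᵇ-decode (false ∷ d) = cong (false ∷_) (encℕᵇ-decode d)
encℕᵇ-decode (true ∷ d)  = cong (true ∷_) (encℕᵇ-decode d)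

decode-encℕᵇ : ∀ b → decode (encℕᵇ b) ≡ b
decode-encℕᵇ zeroᵇ    = refl
decode-encℕᵇ 2[1+ b ] = cong 2[1+_] (decode-encℕᵇ b)
decode-encℕᵇ 1+[2 b ] = cong 1+[2_] (decode-encℕᵇ b)

value : Str → ℕ
value d = toℕ (decode d)

encℕ-value : ∀ d → encℕ (value d) ≡ d
encℕ-value d = trans (cong encℕᵇ (fromℕ-toℕ (decode d))) (encℕᵇ-decode d)

value-encℕ : ∀ n → value (encℕ n) ≡ n
value-encℕ n = trans (cong toℕ (decode-encℕᵇ (fromℕ n))) (toℕ-fromℕ n)

digit : Bool → ℕ
digit false = 1
digit true  = 2

value-∷ : ∀ c d → value (c ∷ d) ≡ digit c + 2 * value d
value-∷ false d = refl
value-∷ true  d = *-suc 2 (value d)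

value-++ : ∀ a b → value (a ++ b) ≡ value a + 2 ^ length a * value b
value-++ []      b = sym (+-identityʳ (value b))
value-++ (c ∷ a) b = begin
  value (c ∷ a ++ b)                               ≡⟨ value-∷ c (a ++ b) ⟩
  digit c + 2 * value (a ++ b)                     ≡⟨ cong (λ v → digit c + 2 * v) (value-++ a b) ⟩
  digit c + 2 * (value a + 2 ^ length a * value b)
    ≡⟨ solve 4 (λ c x p y → c :+ con 2 :* (x :+ p :* y) := (c :+ con 2 :* x) :+ con 2 :* p :* y) refl
             (digit c) (value a) (2 ^ length a) (value b) ⟩
  (digit c + 2 * value a) + 2 * 2 ^ length a * value b ≡⟨ cong (_+ _) (value-∷ c a) ⟨
  value (c ∷ a) + 2 ^ length (c ∷ a) * value b ∎
  where open ≡-Reasoning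

suc-value-replicate-false : ∀ j → suc (value (replicate j false)) ≡ 2 ^ j
suc-value-replicate-false zero    = refl
suc-value-replicate-false (suc j) = trans (sym (*-suc 2 (value (replicate j false))))
                                          (cong (2 *_) (suc-value-replicate-false j))

value-+2-≤ : ∀ d → value d + 2 ≤ 2 ^ suc (length d)
value-+2-≤ []      = ≤-refl
value-+2-≤ (c ∷ d) = begin
  value (c ∷ d) + 2             ≡⟨ cong (_+ 2) (value-∷ c d) ⟩
  digit c + 2 * value d + 2     ≤⟨ +-monoˡ-≤ 2 (+-monoˡ-≤ (2 * value d) (digit≤2 c)) ⟩
  2 + 2 * value d + 2           ≡⟨ solve 1 (λ v → con 2 :+ con 2 :* v :+ con 2 := con 2 :* (v :+ con 2)) refl (value d) ⟩
  2 * (value d + 2)             ≤⟨ *-monoʳ-≤ 2 (value-+2-≤ d) ⟩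
  2 ^ suc (length (c ∷ d)) ∎
  where open ≤-Reasoning
        digit≤2 : ∀ c → digit c ≤ 2
        digit≤2 false = s≤s z≤n
        digit≤2 true  = ≤-refl

split-at-last-true : ∀ d → (Σ ℕ λ j → d ≡ replicate j false)
                         ⊎ (Σ Str λ out → Σ ℕ λ j → d ≡ out ++ true ∷ replicate j false)
split-at-last-true [] = inj₁ (0 , refl)
split-at-last-true (c ∷ d) with c | split-at-last-true d
... | false | inj₁ (j , d≡)       = inj₁ (suc j , cong (false ∷_) d≡)
... | true  | inj₁ (j , d≡)       = inj₂ ([] , j , cong (true ∷_) d≡)
... | c     | inj₂ (out , j , d≡) = inj₂ (c ∷ out , j , cong (c ∷_) d≡)

2^+<2^ : ∀ {a b c} → b < 2 ^ a → a < c → 2 ^ a + b < 2 ^ c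
2^+<2^ {a} {b} {c} b<2^a a<c = begin-strict
  2 ^ a + b      <⟨ +-monoʳ-< (2 ^ a) b<2^a ⟩
  2 ^ a + 2 ^ a  ≡⟨ 2^[1+n]≡2^n+2^n a ⟨
  2 ^ suc a      ≤⟨ ^-monoʳ-≤ 2 a<c ⟩
  2 ^ c ∎
  where open ≤-Reasoning

2^+-injective : ∀ {a b c e} → b < 2 ^ a → e < 2 ^ c → 2 ^ a + b ≡ 2 ^ c + e → a ≡ c
2^+-injective {a} {b} {c} {e} b<2^a e<2^c eq with <-cmp a c
... | tri≈ _ a≡c _ = a≡c
... | tri< a<c _ _ = ⊥-elim (<-irrefl eq (<-≤-trans (2^+<2^ b<2^a a<c) (m≤m+n (2 ^ c) e)))
... | tri> _ _ c<a = ⊥-elim (<-irrefl (sym eq) (<-≤-trans (2^+<2^ e<2^c c<a) (m≤m+n (2 ^ a) b)))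

value-last-true : ∀ out j → value (out ++ true ∷ replicate j false) ≡ 2 ^ (length out + suc j) + value out
value-last-true out j = begin
  value (out ++ true ∷ replicate j false)                ≡⟨ value-++ out _ ⟩
  value out + 2 ^ length out * (2 * suc (value 0ʲ))
    ≡⟨ cong (λ p → value out + 2 ^ length out * (2 * p)) (suc-value-replicate-false j) ⟩
  value out + 2 ^ length out * 2 ^ suc j                 ≡⟨ cong (value out +_) (^-distribˡ-+-* 2 (length out) (suc j)) ⟨
  value out + 2 ^ (length out + suc j)                   ≡⟨ +-comm (value out) _ ⟩
  2 ^ (length out + suc j) + value out ∎
  where open ≡-Reasoning
        0ʲ : Str
        0ʲ = replicate j false

encℕ-2^+ : ∀ m r → suc r < 2 ^ m → Σ ℕ λ j →
  (encℕ (2 ^ m + r) ≡ encℕ r ++ true ∷ replicate j false) × (length (encℕ r) + suc j ≡ m)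
encℕ-2^+ m r r+1<2^m with split-at-last-true (encℕ (2 ^ m + r))
... | inj₁ (j , d≡0ʲ) = ⊥-elim (0≢1+n (+-cancelˡ-≡ (2 ^ m) 0 (suc r) (subst (λ i → 2 ^ i + 0 ≡ 2 ^ m + suc r) j≡m eq)))
  where
  eq : 2 ^ j + 0 ≡ 2 ^ m + suc r
  eq = begin
    2 ^ j + 0                          ≡⟨ +-identityʳ _ ⟩
    2 ^ j                              ≡⟨ suc-value-replicate-false j ⟨
    suc (value (replicate j false))    ≡⟨ cong (suc ∘ value) d≡0ʲ ⟨
    suc (value (encℕ (2 ^ m + r)))     ≡⟨ cong suc (value-encℕ (2 ^ m + r)) ⟩
    suc (2 ^ m + r)                    ≡⟨ +-suc (2 ^ m) r ⟨
    2 ^ m + suc r ∎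
    where open ≡-Reasoning
  j≡m : j ≡ m
  j≡m = 2^+-injective (m^n>0 2 j) r+1<2^m eq
... | inj₂ (out , j , d≡) = j , trans d≡ (cong (_++ true ∷ replicate j false) out≡encℕr)
                          , subst (λ o → length o + suc j ≡ m) out≡encℕr k≡m
  where
  k : ℕ
  k = length out + suc j
  eq : 2 ^ k + value out ≡ 2 ^ m + r
  eq = trans (sym (value-last-true out j)) (trans (cong value (sym d≡)) (value-encℕ (2 ^ m + r)))
  value-out<2^k : value out < 2 ^ k
  value-out<2^k = <-≤-trans (m<m+n (value out) (s≤s z≤n))
                  (≤-trans (value-+2-≤ out) (^-monoʳ-≤ 2 (≤-trans (s≤s (m≤m+n (length out) j))
                                                                  (≤-reflexive (sym (+-suc (length out) j))))))
  k≡m : k ≡ m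
  k≡m = 2^+-injective value-out<2^k (<-trans (n<1+n r) r+1<2^m) eq
  out≡encℕr : out ≡ encℕ r
  out≡encℕr = trans (sym (encℕ-value out))
                    (cong encℕ (+-cancelˡ-≡ (2 ^ m) _ _ (subst (λ i → 2 ^ i + value out ≡ 2 ^ m + r) k≡m eq)))

-- Polynomial bounds

0^n≤1 : ∀ c → 0 ^ c ≤ 1
0^n≤1 zero    = ≤-refl
0^n≤1 (suc c) = z≤n

n+n^c≤n^[2+c]+1 : ∀ n c → n + n ^ c ≤ n ^ (2 + c) + 1
n+n^c≤n^[2+c]+1 zero    c = 0^n≤1 c
n+n^c≤n^[2+c]+1 (suc k) c = begin
  suc k + P                           ≡⟨ +-comm (suc k) P ⟩
  P + suc k                           ≡⟨ +-suc P k ⟩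
  suc (P + k)                         ≤⟨ s≤s (+-monoʳ-≤ P (m≤m*n k P {{m^n≢0 (suc k) c}})) ⟩
  suc (P + k * P)                     ≤⟨ s≤s (m≤m+n (suc k * P) (k * (suc k * P))) ⟩
  suc (suc k * (suc k * P))           ≡⟨ +-comm 1 _ ⟩
  suc k ^ (2 + c) + 1 ∎
  where open ≤-Reasoning
        P : ℕ
        P = suc k ^ c

n+n^c+[c+2]≤n^[2+c]+[c+3] : ∀ n c → n + n ^ c + (c + 2) ≤ n ^ (2 + c) + (c + 3)
n+n^c+[c+2]≤n^[2+c]+[c+3] n c = begin
  n + n ^ c + (c + 2)             ≤⟨ +-monoˡ-≤ (c + 2) (n+n^c≤n^[2+c]+1 n c) ⟩
  n ^ (2 + c) + 1 + (c + 2)       ≡⟨ +-assoc (n ^ (2 + c)) 1 (c + 2) ⟩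
  n ^ (2 + c) + suc (c + 2)       ≡⟨ cong (n ^ (2 + c) +_) (+-suc c 2) ⟨
  n ^ (2 + c) + (c + 3) ∎
  where open ≤-Reasoning

[3+n]^c≤n^[2c]+6^c : ∀ n c → (3 + n) ^ c ≤ n ^ (2 * c) + 6 ^ c
[3+n]^c≤n^[2c]+6^c n c with n ≤? 2
... | yes n≤2 = ≤-trans (^-monoˡ-≤ c (+-monoʳ-≤ 3 (≤-trans n≤2 (n≤1+n 2)))) (m≤n+m (6 ^ c) (n ^ (2 * c)))
... | no n≰2  = ≤-trans (^-monoˡ-≤ c 3+n≤n^2) (≤-trans (≤-reflexive (^-*-assoc n 2 c)) (m≤m+n _ _))
  where
  3≤n : 3 ≤ n
  3≤n = ≰⇒> n≰2
  3+n≤n^2 : 3 + n ≤ n ^ 2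
  3+n≤n^2 = begin
    3 + n        ≤⟨ +-monoˡ-≤ n 3≤n ⟩
    n + n        ≡⟨ cong (n +_) (+-identityʳ n) ⟨
    2 * n        ≤⟨ *-monoˡ-≤ n (≤-trans (n≤1+n 2) 3≤n) ⟩
    n * n        ≡⟨ cong (n *_) (*-identityʳ n) ⟨
    n ^ 2 ∎
    where open ≤-Reasoning

^-monoʳ-≤⁺ : ∀ n {a b} → 1 ≤ a → a ≤ b → n ^ a ≤ n ^ b
^-monoʳ-≤⁺ zero    {suc a} {suc b} _ _ = z≤n
^-monoʳ-≤⁺ (suc n) _ a≤b = ^-monoʳ-≤ (suc n) a≤b

-- Running machines

replicate-ʳ++ : ∀ {X : Set} k (x : X) l → replicate k x ʳ++ l ≡ replicate k x ++ l
replicate-ʳ++ zero    x l = refl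
replicate-ʳ++ (suc k) x l = trans (replicate-ʳ++ k x (x ∷ l)) (replicate-++-∷ k)
  where
  replicate-++-∷ : ∀ k → replicate k x ++ x ∷ l ≡ x ∷ replicate k x ++ l
  replicate-++-∷ zero    = refl
  replicate-++-∷ (suc k) = cong (x ∷_) (replicate-++-∷ k)

module Machine (M : TM) where
  open TM M

  cfgʳ : Fin nQ → List (Sym M) → List (Sym M) → Config M
  cfgʳ q l []      = cfg q l (blank M) []
  cfgʳ q l (a ∷ r) = cfg q l a r

  cfgˡ : Fin nQ → List (Sym M) → List (Sym M) → Config M
  cfgˡ q []      r = cfg q [] (blank M) r
  cfgˡ q (a ∷ l) r = cfg q l a r

  readBits-bitSym : ∀ c {r} → readBits M r ≡ [] → readBits M (bitSym M c ∷ r) ≡ c ∷ []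
  readBits-bitSym false r-empty = cong (false ∷_) r-empty
  readBits-bitSym true  r-empty = cong (true ∷_) r-empty

  readBits≡[_] : ∀ c {h r} → readBits M (h ∷ r) ≡ c ∷ [] → h ≡ bitSym M c × readBits M r ≡ []
  readBits≡[ false ] {fs fz}      out = refl , cong (drop 1) out
  readBits≡[ true  ] {fs (fs fz)} out = refl , cong (drop 1) out
  readBits≡[ false ] {fs (fs fz)} ()
  readBits≡[ true  ] {fs fz}      ()
  readBits≡[ _ ] {fz}             ()
  readBits≡[ _ ] {fs (fs (fs _))} ()

  readBits-split : ∀ w → Σ (List (Sym M)) λ rest → w ≡ map (bitSym M) (readBits M w) ++ rest × readBits M rest ≡ []
  readBits-split []                = [] , refl , refl
  readBits-split w@(fz ∷ _)        = w , refl , refl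
  readBits-split w@(fs (fs (fs _)) ∷ _) = w , refl , refl
  readBits-split (fs fz ∷ w)       with readBits-split w
  ... | rest , w≡ , rest-empty = rest , cong (fs fz ∷_) w≡ , rest-empty
  readBits-split (fs (fs fz) ∷ w)  with readBits-split w
  ... | rest , w≡ , rest-empty = rest , cong (fs (fs fz) ∷_) w≡ , rest-empty

  step-running : ∀ {q} l h r → ¬ q ≡ halt →
    step M (cfg q l h r) ≡ (let (q′ , s′ , m) = δ q h in move M m l s′ r (cfg q l h r) q′)
  step-running {q} l h r q≢halt with q ≟ halt
  ... | yes q≡halt = ⊥-elim (q≢halt q≡halt)
  ... | no _       = refl

  step-halted : ∀ {q} l h r → q ≡ halt → step M (cfg q l h r) ≡ cfg q l h r
  step-halted {q} l h r q≡halt with q ≟ halt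
  ... | yes _      = refl
  ... | no q≢halt = ⊥-elim (q≢halt q≡halt)

  step-R : ∀ {q′ s′} q a l r → ¬ q ≡ halt → δ q a ≡ (q′ , s′ , R) →
           step M (cfgʳ q l (a ∷ r)) ≡ cfgʳ q′ (s′ ∷ l) r
  step-R q a l r q≢halt δqa rewrite step-running l a r q≢halt | δqa with r
  ... | []    = refl
  ... | _ ∷ _ = refl

  step-L : ∀ {q′ s′} q a l r → ¬ q ≡ halt → δ q a ≡ (q′ , s′ , L) →
           step M (cfgˡ q (a ∷ l) r) ≡ cfgˡ q′ l (s′ ∷ r)
  step-L q a l r q≢halt δqa rewrite step-running l a r q≢halt | δqa with l
  ... | []    = refl
  ... | _ ∷ _ = refl

  step-S : ∀ {q′ s′} q a l r → ¬ q ≡ halt → δ q a ≡ (q′ , s′ , S) →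
           step M (cfg q l a r) ≡ cfg q′ l s′ r
  step-S q a l r q≢halt δqa rewrite step-running l a r q≢halt | δqa = refl

  run-+ : ∀ s t c → run M (s + t) c ≡ run M t (run M s c)
  run-+ zero    t c = refl
  run-+ (suc s) t c = run-+ s t (step M c)

  run-seq : ∀ s t {c c′ c″} → run M s c ≡ c′ → run M t c′ ≡ c″ → run M (s + t) c ≡ c″
  run-seq s t {c} s-steps t-steps = trans (run-+ s t c) (trans (cong (run M t) s-steps) t-steps)

  run-halted : ∀ t c → Config.state c ≡ halt → run M t c ≡ c
  run-halted zero    c          _      = refl
  run-halted (suc t) (cfg q l h r) q≡halt rewrite step-halted l h r q≡halt = run-halted t _ q≡halt

  run-halted-≤ : ∀ {t T} c → t ≤ T → Config.state (run M t c) ≡ halt → run M T c ≡ run M t c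
  run-halted-≤ {t} {T} c t≤T halted = begin
    run M T c                    ≡⟨ cong (λ s → run M s c) (m+[n∸m]≡n t≤T) ⟨
    run M (t + (T ∸ t)) c        ≡⟨ run-+ t (T ∸ t) c ⟩
    run M (T ∸ t) (run M t c)    ≡⟨ run-halted (T ∸ t) (run M t c) halted ⟩
    run M t c ∎
    where open ≡-Reasoning

  record HaltsWithin (t : ℕ) (c : Config M) (y : Str) : Set where
    constructor halts
    field
      halted : Config.state (run M t c) ≡ halt
      output≡ : output M (run M t c) ≡ y

  haltsWithin-mono : ∀ {t T c y} → t ≤ T → HaltsWithin t c y → HaltsWithin T c y
  haltsWithin-mono {t} {T} {c} t≤T (halts halted out) =
    halts (subst (λ c′ → Config.state c′ ≡ halt) (sym same) halted) (subst (λ c′ → output M c′ ≡ _) (sym same) out)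
    where
    same : run M T c ≡ run M t c
    same = run-halted-≤ c t≤T halted

  haltsWithin-after : ∀ s {t c c′ y} → run M s c ≡ c′ → HaltsWithin t c′ y → HaltsWithin (s + t) c y
  haltsWithin-after s {t} {c} refl (halts halted out) =
    halts (trans (cong Config.state (run-+ s t c)) halted) (trans (cong (output M) (run-+ s t c)) out)

  halted-cfgʳ : ∀ {l w y} → readBits M w ≡ y → HaltsWithin 0 (cfgʳ halt l w) y
  halted-cfgʳ {w = []}    out = halts refl out
  halted-cfgʳ {w = _ ∷ _} out = halts refl out

  computesWithin : ∀ {t x y} → HaltsWithin t (initConfig M x) y → ComputesWithin M t x y
  computesWithin (halts halted out) = halted , out

  computesWithin-mono : ∀ {t T x y} → t ≤ T → ComputesWithin M t x y → ComputesWithin M T x y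
  computesWithin-mono t≤T (halted , out) = computesWithin (haltsWithin-mono t≤T (halts halted out))

  computesWithin-run : ∀ x {t T y c} → t ≤ T → run M t (initConfig M x) ≡ c →
                       Config.state c ≡ halt → output M c ≡ y → ComputesWithin M T x y
  computesWithin-run x t≤T refl halted out = computesWithin (haltsWithin-mono t≤T (halts halted out))

  sweep-R : ∀ {q} (f : Sym M → Sym M) ws l r → ¬ q ≡ halt → All (λ a → δ q a ≡ (q , f a , R)) ws →
            run M (length ws) (cfgʳ q l (ws ++ r)) ≡ cfgʳ q (map f ws ʳ++ l) r
  sweep-R f []       l r _       []          = refl
  sweep-R f (a ∷ ws) l r q≢halt (δqa ∷ δws) =
    trans (cong (run M (length ws)) (step-R _ a l (ws ++ r) q≢halt δqa)) (sweep-R f ws (f a ∷ l) r q≢halt δws)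

  sweep-L : ∀ {q} (f : Sym M → Sym M) ws l r → ¬ q ≡ halt → All (λ a → δ q a ≡ (q , f a , L)) ws →
            run M (length ws) (cfgˡ q (ws ʳ++ l) r) ≡ cfgˡ q l (map f ws ++ r)
  sweep-L f []       l r _       []          = refl
  sweep-L {q} f (a ∷ ws) l r q≢halt (δqa ∷ δws) = begin
    run M (suc (length ws)) (cfgˡ q (ws ʳ++ a ∷ l) r)
      ≡⟨ cong (λ t → run M t (cfgˡ q (ws ʳ++ a ∷ l) r)) (+-comm 1 (length ws)) ⟩
    run M (length ws + 1) (cfgˡ q (ws ʳ++ a ∷ l) r)           ≡⟨ run-+ (length ws) 1 _ ⟩
    step M (run M (length ws) (cfgˡ q (ws ʳ++ a ∷ l) r))      ≡⟨ cong (step M) (sweep-L f ws (a ∷ l) r q≢halt δws) ⟩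
    step M (cfgˡ q (a ∷ l) (map f ws ++ r))                   ≡⟨ step-L q a l _ q≢halt δqa ⟩
    cfgˡ q l (f a ∷ map f ws ++ r) ∎
    where open ≡-Reasoning

  sweep-R-replicate : ∀ {q s} k a l r → ¬ q ≡ halt → δ q a ≡ (q , s , R) →
                      run M k (cfgʳ q l (replicate k a ++ r)) ≡ cfgʳ q (replicate k s ++ l) r
  sweep-R-replicate {q} {s} k a l r q≢halt δqa = begin
    run M k (cfgʳ q l (replicate k a ++ r))
      ≡⟨ cong (λ t → run M t (cfgʳ q l (replicate k a ++ r))) (length-replicate k) ⟨
    run M (length (replicate k a)) (cfgʳ q l (replicate k a ++ r))
      ≡⟨ sweep-R (λ _ → s) (replicate k a) l r q≢halt (replicate⁺ k δqa) ⟩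
    cfgʳ q (map (λ _ → s) (replicate k a) ʳ++ l) r
      ≡⟨ cong (λ ws → cfgʳ q (ws ʳ++ l) r) (map-replicate (λ _ → s) k a) ⟩
    cfgʳ q (replicate k s ʳ++ l) r
      ≡⟨ cong (λ ws → cfgʳ q ws r) (replicate-ʳ++ k s l) ⟩
    cfgʳ q (replicate k s ++ l) r ∎
    where open ≡-Reasoning

  sweep-L-replicate : ∀ {q s} k a l r → ¬ q ≡ halt → δ q a ≡ (q , s , L) →
                      run M k (cfgˡ q (replicate k a ++ l) r) ≡ cfgˡ q l (replicate k s ++ r)
  sweep-L-replicate {q} {s} k a l r q≢halt δqa = begin
    run M k (cfgˡ q (replicate k a ++ l) r)
      ≡⟨ cong₂ (λ t ws → run M t (cfgˡ q ws r)) (length-replicate k) (replicate-ʳ++ k a l) ⟨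
    run M (length (replicate k a)) (cfgˡ q (replicate k a ʳ++ l) r)
      ≡⟨ sweep-L (λ _ → s) (replicate k a) l r q≢halt (replicate⁺ k δqa) ⟩
    cfgˡ q l (map (λ _ → s) (replicate k a) ++ r)
      ≡⟨ cong (λ ws → cfgˡ q l (ws ++ r)) (map-replicate (λ _ → s) k a) ⟩
    cfgˡ q l (replicate k s ++ r) ∎
    where open ≡-Reasoning

  sweep-R-bits : ∀ {q} ds l r → ¬ q ≡ halt → (∀ c → δ q (bitSym M c) ≡ (q , bitSym M c , R)) →
                 run M (length ds) (cfgʳ q l (map (bitSym M) ds ++ r)) ≡ cfgʳ q (map (bitSym M) ds ʳ++ l) r
  sweep-R-bits {q} ds l r q≢halt δ-bit = begin
    run M (length ds) (cfgʳ q l (bits ++ r))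
      ≡⟨ cong (λ t → run M t (cfgʳ q l (bits ++ r))) (length-map (bitSym M) ds) ⟨
    run M (length bits) (cfgʳ q l (bits ++ r))
      ≡⟨ sweep-R id bits l r q≢halt (map⁺ (All.universal δ-bit ds)) ⟩
    cfgʳ q (map id bits ʳ++ l) r
      ≡⟨ cong (λ ws → cfgʳ q (ws ʳ++ l) r) (map-id bits) ⟩
    cfgʳ q (bits ʳ++ l) r ∎
    where open ≡-Reasoning
          bits : List (Sym M)
          bits = map (bitSym M) ds

  sweep-L-bits : ∀ {q} ds l r → ¬ q ≡ halt → (∀ c → δ q (bitSym M c) ≡ (q , bitSym M c , L)) →
                 run M (length ds) (cfgˡ q (map (bitSym M) ds ʳ++ l) r) ≡ cfgˡ q l (map (bitSym M) ds ++ r)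
  sweep-L-bits {q} ds l r q≢halt δ-bit = begin
    run M (length ds) (cfgˡ q (bits ʳ++ l) r)
      ≡⟨ cong (λ t → run M t (cfgˡ q (bits ʳ++ l) r)) (length-map (bitSym M) ds) ⟨
    run M (length bits) (cfgˡ q (bits ʳ++ l) r)
      ≡⟨ sweep-L id bits l r q≢halt (map⁺ (All.universal δ-bit ds)) ⟩
    cfgˡ q l (map id bits ++ r)
      ≡⟨ cong (λ ws → cfgˡ q l (ws ++ r)) (map-id bits) ⟩
    cfgˡ q l (bits ++ r) ∎
    where open ≡-Reasoning
          bits : List (Sym M)
          bits = map (bitSym M) ds

module Simulation (M M′ : TM)
  (embedState    : Fin (TM.nQ M) → Fin (TM.nQ M′))
  (embedSym      : Sym M → Sym M′)
  (embed-blank   : embedSym (blank M) ≡ blank M′)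
  (embed-running : ∀ q → ¬ embedState q ≡ TM.halt M′)
  (embed-δ       : ∀ q s → ¬ q ≡ TM.halt M →
                   TM.δ M′ (embedState q) (embedSym s) ≡
                   (embedState (proj₁ (TM.δ M q s)) , embedSym (proj₁ (proj₂ (TM.δ M q s))) , proj₂ (proj₂ (TM.δ M q s))))
  where

  infixr 5 _∷_ blank′∷_ blank∷_
  infix  4 _≈ᵗ_ _≈_

  -- Tape halves agree cellwise up to the embedding; either side may carry extra blanks at its end.
  data _≈ᵗ_ : List (Sym M′) → List (Sym M) → Set where
    []       : [] ≈ᵗ []
    _∷_      : ∀ a {l′ l} → l′ ≈ᵗ l → embedSym a ∷ l′ ≈ᵗ a ∷ l
    blank′∷_ : ∀ {l′} → l′ ≈ᵗ [] → blank M′ ∷ l′ ≈ᵗ []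
    blank∷_  : ∀ {l} → [] ≈ᵗ l → [] ≈ᵗ blank M ∷ l

  _≈_ : Config M′ → Config M → Set
  cfg q′ l′ h′ r′ ≈ cfg q l h r = q′ ≡ embedState q × h′ ≡ embedSym h × l′ ≈ᵗ l × r′ ≈ᵗ r

  bits-≈ᵗ : (∀ b → embedSym (bitSym M b) ≡ bitSym M′ b) → ∀ x → map (bitSym M′) x ≈ᵗ map (bitSym M) x
  bits-≈ᵗ embed-bit []      = []
  bits-≈ᵗ embed-bit (b ∷ x) = subst (λ a → a ∷ map (bitSym M′) x ≈ᵗ _) (embed-bit b) (bitSym M b ∷ bits-≈ᵗ embed-bit x)

  blanks-≈ᵗ : ∀ k {l′} → l′ ≈ᵗ [] → replicate k (blank M′) ++ l′ ≈ᵗ []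
  blanks-≈ᵗ zero    l′≈ = l′≈
  blanks-≈ᵗ (suc k) l′≈ = blank′∷ blanks-≈ᵗ k l′≈

  start-≈ : (∀ b → embedSym (bitSym M b) ≡ bitSym M′ b) → ∀ {l′} → l′ ≈ᵗ [] → ∀ x →
            Machine.cfgʳ M′ (embedState (TM.start M)) l′ (map (bitSym M′) x) ≈ initConfig M x
  start-≈ embed-bit l′≈ []      = refl , sym embed-blank , l′≈ , []
  start-≈ embed-bit l′≈ (b ∷ x) = refl , sym (embed-bit b) , l′≈ , bits-≈ᵗ embed-bit x

  move-≈ : ∀ m q s {l′ l r′ r} c′ c → l′ ≈ᵗ l → r′ ≈ᵗ r →
           move M′ m l′ (embedSym s) r′ c′ (embedState q) ≈ move M m l s r c q
  move-≈ L q s c′ c []          r≈ = refl , sym embed-blank , [] , s ∷ r≈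
  move-≈ L q s c′ c (a ∷ l≈)    r≈ = refl , refl , l≈ , s ∷ r≈
  move-≈ L q s c′ c (blank′∷ l≈) r≈ = refl , sym embed-blank , l≈ , s ∷ r≈
  move-≈ L q s c′ c (blank∷ l≈) r≈ = refl , sym embed-blank , l≈ , s ∷ r≈
  move-≈ R q s c′ c l≈ []          = refl , sym embed-blank , s ∷ l≈ , []
  move-≈ R q s c′ c l≈ (a ∷ r≈)    = refl , refl , s ∷ l≈ , r≈
  move-≈ R q s c′ c l≈ (blank′∷ r≈) = refl , sym embed-blank , s ∷ l≈ , r≈
  move-≈ R q s c′ c l≈ (blank∷ r≈) = refl , sym embed-blank , s ∷ l≈ , r≈
  move-≈ S q s c′ c l≈ r≈          = refl , refl , l≈ , r≈

  step-≈ : ∀ c′ c → c′ ≈ c → ¬ Config.state c ≡ TM.halt M → step M′ c′ ≈ step M c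
  step-≈ (cfg _ l′ _ r′) (cfg q l h r) (refl , refl , l≈ , r≈) q≢halt
    rewrite Machine.step-running M l h r q≢halt
          | Machine.step-running M′ l′ (embedSym h) r′ (embed-running q)
          | embed-δ q h q≢halt
    with TM.δ M q h
  ... | q₁ , s₁ , m = move-≈ m q₁ s₁ (cfg (embedState q) l′ (embedSym h) r′) (cfg q l h r) l≈ r≈

  simulate : ∀ t c′ c → c′ ≈ c → Config.state (run M t c) ≡ TM.halt M →
             Σ ℕ λ t′ → t′ ≤ t × run M′ t′ c′ ≈ run M t c
  simulate zero    c′ c c′≈c _ = 0 , z≤n , c′≈c
  simulate (suc t) c′ c c′≈c halts = from (Config.state c ≟ TM.halt M)
    where
    from : Dec (Config.state c ≡ TM.halt M) → Σ ℕ λ t′ → t′ ≤ suc t × run M′ t′ c′ ≈ run M (suc t) c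
    from (yes c-halted) = 0 , z≤n , subst (c′ ≈_) (sym (Machine.run-halted M (suc t) c c-halted)) c′≈c
    from (no c-running) with simulate t (step M′ c′) (step M c) (step-≈ c′ c c′≈c c-running) halts
    ... | t′ , t′≤t , ≈end = suc t′ , s≤s t′≤t , ≈end

  module _ (readBits-embed : ∀ a w′ w → readBits M′ w′ ≡ readBits M w →
                             readBits M′ (embedSym a ∷ w′) ≡ readBits M (a ∷ w)) where

    readBits-≈ᵗ : ∀ {w′ w} → w′ ≈ᵗ w → readBits M′ w′ ≡ readBits M w
    readBits-≈ᵗ []          = refl
    readBits-≈ᵗ (a ∷ w≈)    = readBits-embed a _ _ (readBits-≈ᵗ w≈)
    readBits-≈ᵗ (blank′∷ _) = refl
    readBits-≈ᵗ (blank∷ _)  = refl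

    output-≈ : ∀ c′ c → c′ ≈ c → output M′ c′ ≡ output M c
    output-≈ (cfg _ _ _ r′) (cfg _ _ h r) (_ , refl , _ , r≈) = readBits-embed h r′ r (readBits-≈ᵗ r≈)

-- The census machine

-- On 1ⁿ⁺² it keeps the first 1, turns the others into 0s and erases the last one, leaving 1 0ⁿ = encℕ (2ⁿ⁺¹).
censusδ : Fin 5 → Fin 3 → Fin 5 × Fin 3 × Move
censusδ 𝟘 𝟘 = 𝟜 , 𝟘 , S
censusδ 𝟘 𝟚 = 𝟙 , 𝟚 , R
censusδ 𝟙 𝟚 = 𝟙 , 𝟙 , R
censusδ 𝟙 𝟘 = 𝟚 , 𝟘 , L
censusδ 𝟚 𝟚 = 𝟜 , 𝟙 , S
censusδ 𝟚 𝟙 = 𝟛 , 𝟘 , L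
censusδ 𝟛 𝟙 = 𝟛 , 𝟙 , L
censusδ 𝟛 𝟚 = 𝟜 , 𝟚 , S
censusδ q s = 𝟜 , s , S

censusMachine : TM
censusMachine = record { nQ = 5 ; g = 0 ; start = 𝟘 ; halt = 𝟜 ; δ = censusδ }

module _ where
  open Machine censusMachine

  census-mark-and-sweep : ∀ m → run censusMachine (2 + m) (initConfig censusMachine (replicate (2 + m) true))
                                ≡ cfgʳ 𝟙 (replicate (suc m) 𝟙 ++ 𝟚 ∷ []) []
  census-mark-and-sweep m = run-seq 1 (suc m) {c = initConfig censusMachine (replicate (2 + m) true)}
                              (step-R 𝟘 𝟚 [] (map (bitSym censusMachine) (replicate (suc m) true)) (λ ()) refl) (begin
    run censusMachine (suc m) (cfgʳ 𝟙 (𝟚 ∷ []) (map (bitSym censusMachine) (replicate (suc m) true)))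
      ≡⟨ cong (run censusMachine (suc m) ∘ cfgʳ 𝟙 (𝟚 ∷ [])) (map-replicate _ (suc m) true) ⟩
    run censusMachine (suc m) (cfgʳ 𝟙 (𝟚 ∷ []) (replicate (suc m) 𝟚))
      ≡⟨ cong (run censusMachine (suc m) ∘ cfgʳ 𝟙 (𝟚 ∷ [])) (++-identityʳ (replicate (suc m) 𝟚)) ⟨
    run censusMachine (suc m) (cfgʳ 𝟙 (𝟚 ∷ []) (replicate (suc m) 𝟚 ++ []))
      ≡⟨ sweep-R-replicate (suc m) 𝟚 (𝟚 ∷ []) [] (λ ()) refl ⟩
    cfgʳ 𝟙 (replicate (suc m) 𝟙 ++ 𝟚 ∷ []) [] ∎)
    where open ≡-Reasoning

  census-erase-last : ∀ l → run censusMachine 2 (cfgʳ 𝟙 (𝟙 ∷ l) []) ≡ cfgˡ 𝟛 l (𝟘 ∷ 𝟘 ∷ [])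
  census-erase-last l = run-seq 1 1 {c = cfgʳ 𝟙 (𝟙 ∷ l) []} (step-L 𝟙 𝟘 (𝟙 ∷ l) [] (λ ()) refl)
                                                              (step-L 𝟚 𝟙 l (𝟘 ∷ []) (λ ()) refl)

  census-return : ∀ m r → run censusMachine (m + 1) (cfgˡ 𝟛 (replicate m 𝟙 ++ 𝟚 ∷ []) r)
                          ≡ cfg 𝟜 [] 𝟚 (replicate m 𝟙 ++ r)
  census-return m r = run-seq m 1 (sweep-L-replicate m 𝟙 (𝟚 ∷ []) r (λ ()) refl) (step-S 𝟛 𝟚 [] _ (λ ()) refl)

  readBits-zeros : ∀ m r → readBits censusMachine (replicate m 𝟙 ++ 𝟘 ∷ r) ≡ replicate m false
  readBits-zeros zero    r = refl
  readBits-zeros (suc m) r = cong (false ∷_) (readBits-zeros m r)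

  encℕ-2^[1+n] : ∀ m → encℕ (2 ^ suc m) ≡ true ∷ replicate m false
  encℕ-2^[1+n] m = trans (cong (λ p → encℕ (2 * p)) (sym (suc-value-replicate-false m)))
                         (encℕ-value (true ∷ replicate m false))

  census-machine-correct : ∀ N → ComputesWithin censusMachine (N ^ 2 + 2) (replicate N true) (encℕ (2 ^ N / 2))
  census-machine-correct zero          = refl , refl
  census-machine-correct (suc zero)    = refl , refl
  census-machine-correct (suc (suc m)) = computesWithin-run (replicate (2 + m) true) time-bound runs refl
    (trans (cong (true ∷_) (readBits-zeros m (𝟘 ∷ [])))
           (sym (trans (cong encℕ (2^[1+n]/2≡2^n (suc m))) (encℕ-2^[1+n] m))))
    where
    runs : run censusMachine ((2 + m) + (2 + (m + 1))) (initConfig censusMachine (replicate (2 + m) true))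
           ≡ cfg 𝟜 [] 𝟚 (replicate m 𝟙 ++ 𝟘 ∷ 𝟘 ∷ [])
    runs = run-seq (2 + m) (2 + (m + 1)) {c = initConfig censusMachine (replicate (2 + m) true)} (census-mark-and-sweep m)
             (run-seq 2 (m + 1) {c = cfgʳ 𝟙 (replicate (suc m) 𝟙 ++ 𝟚 ∷ []) []}
                (census-erase-last (replicate m 𝟙 ++ 𝟚 ∷ [])) (census-return m (𝟘 ∷ 𝟘 ∷ [])))
    time-bound : (2 + m) + (2 + (m + 1)) ≤ (2 + m) ^ 2 + 2
    time-bound = ≤-trans (m≤m+n _ (m * m + 2 * m + 1))
      (≤-reflexive (solve 1 (λ m → ((con 2 :+ m) :+ (con 2 :+ (m :+ con 1))) :+ (m :* m :+ con 2 :* m :+ con 1)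
                                   := (con 2 :+ m) :^ 2 :+ con 2) refl m))

-- The decider

data LeadingZeros : Str → Set where
  zeros     : ∀ k → LeadingZeros (replicate k false ++ [])
  zeros-one : ∀ k y → LeadingZeros (replicate k false ++ true ∷ y)

leading-zeros : ∀ u → LeadingZeros u
leading-zeros []          = zeros 0
leading-zeros (true ∷ y)  = zeros-one 0 y
leading-zeros (false ∷ u) with leading-zeros u
... | zeros k       = zeros (suc k)
... | zeros-one k y = zeros-one (suc k) y

padded-zeros-++ : ∀ A k w → padded A (replicate k false ++ w) ≡ padded A w
padded-zeros-++ A zero    w = refl
padded-zeros-++ A (suc k) w = padded-zeros-++ A k w

-- After the first bit b the decider erases 0s; at a blank it answers b xor true, at a 1 it runs
-- MA on the rest in the copy of MA's states indexed by b, which flips MA's answer when b is true.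
module DeciderMachine (MA : TM) where
  open TM MA using () renaming (nQ to nA; g to gA; start to startA; halt to haltA; δ to δA)

  State : Set
  State = Fin (4 + (nA + nA))

  Symbol : Set
  Symbol = Fin (3 + gA)

  own : Fin 4 → State
  own i = i ↑ˡ (nA + nA)

  HALT : State
  HALT = own 𝟛

  skipping : Bool → State
  skipping false = own 𝟙
  skipping true  = own 𝟚

  copy : Bool → Fin nA → State
  copy false q = 4 ↑ʳ (q ↑ˡ nA)
  copy true  q = 4 ↑ʳ (nA ↑ʳ q)

  flipIf : Bool → Symbol → Symbol
  flipIf true 𝟙 = 𝟚
  flipIf true 𝟚 = 𝟙
  flipIf _    s = s

  δskip : Bool → Symbol → State × Symbol × Move
  δskip b 𝟙 = skipping b , 𝟘 , R
  δskip b 𝟚 = copy b startA , 𝟘 , R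
  δskip b _ = HALT , bitSym MA (b xor true) , S

  δown : Fin 4 → Symbol → State × Symbol × Move
  δown 𝟘 𝟘 = HALT , bitSym MA false , S
  δown 𝟘 𝟙 = skipping false , 𝟘 , R
  δown 𝟘 𝟚 = skipping true , 𝟘 , R
  δown 𝟙 s = δskip false s
  δown 𝟚 s = δskip true s
  δown _ s = HALT , s , S

  δcopy : Bool → Fin nA → Symbol → State × Symbol × Move
  δcopy b q s = if does (q ≟ haltA) then (HALT , flipIf b s , S)
                else (copy b (proj₁ (δA q s)) , proj₁ (proj₂ (δA q s)) , proj₂ (proj₂ (δA q s)))

  δ : State → Symbol → State × Symbol × Move
  δ q s = [ (λ i → δown i s) , (λ j → [ (λ q → δcopy false q s) , (λ q → δcopy true q s) ]′ (splitAt nA j)) ]′ (splitAt 4 q)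

  decider : TM
  decider = record { nQ = 4 + (nA + nA) ; g = gA ; start = own 𝟘 ; halt = HALT ; δ = δ }

  δ-copy : ∀ b q s → δ (copy b q) s ≡ δcopy b q s
  δ-copy false q s rewrite splitAt-↑ˡ nA q nA = refl
  δ-copy true  q s rewrite splitAt-↑ʳ nA nA q = refl

  δ-copy-running : ∀ b q s → ¬ q ≡ haltA →
    δ (copy b q) s ≡ (copy b (proj₁ (δA q s)) , proj₁ (proj₂ (δA q s)) , proj₂ (proj₂ (δA q s)))
  δ-copy-running b q s q≢halt rewrite δ-copy b q s | dec-false (q ≟ haltA) q≢halt = refl

  δ-copy-halted : ∀ b s → δ (copy b haltA) s ≡ (HALT , flipIf b s , S)
  δ-copy-halted b s rewrite δ-copy b haltA s | dec-true (haltA ≟ haltA) refl = refl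

  copy-running : ∀ b q → ¬ copy b q ≡ HALT
  copy-running false q ()
  copy-running true  q ()

  skipping-running : ∀ b → ¬ skipping b ≡ HALT
  skipping-running false ()
  skipping-running true  ()

  flipIf-bitSym : ∀ b c → flipIf b (bitSym MA c) ≡ bitSym decider (b xor c)
  flipIf-bitSym false false = refl
  flipIf-bitSym false true  = refl
  flipIf-bitSym true  false = refl
  flipIf-bitSym true  true  = refl

  start-δ : ∀ b → δ (own 𝟘) (bitSym decider b) ≡ (skipping b , 𝟘 , R)
  start-δ false = refl
  start-δ true  = refl

  skip-δ-0 : ∀ b → δ (skipping b) 𝟙 ≡ (skipping b , 𝟘 , R)
  skip-δ-0 false = refl
  skip-δ-0 true  = refl

  skip-δ-1 : ∀ b → δ (skipping b) 𝟚 ≡ (copy b startA , 𝟘 , R)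
  skip-δ-1 false = refl
  skip-δ-1 true  = refl

  skip-δ-end : ∀ b → δ (skipping b) 𝟘 ≡ (HALT , bitSym decider (b xor true) , S)
  skip-δ-end false = refl
  skip-δ-end true  = refl

  module Sim (b : Bool) = Simulation MA decider (copy b) id refl (copy-running b) (δ-copy-running b)

  embed-bit : ∀ c → bitSym MA c ≡ bitSym decider c
  embed-bit false = refl
  embed-bit true  = refl

  open Machine decider

  skip-zeros : ∀ b k w → run decider (1 + k) (initConfig decider (b ∷ replicate k false ++ w))
                         ≡ cfgʳ (skipping b) (replicate k 𝟘 ++ 𝟘 ∷ []) (map (bitSym decider) w)
  skip-zeros b k w = run-seq 1 k {c = initConfig decider (b ∷ replicate k false ++ w)}
    (step-R (own 𝟘) (bitSym decider b) [] _ (λ ()) (start-δ b))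
    (trans (cong (λ ws → run decider k (cfgʳ (skipping b) (𝟘 ∷ []) ws)) zeros-then-w)
           (sweep-R-replicate k 𝟙 (𝟘 ∷ []) _ (skipping-running b) (skip-δ-0 b)))
    where
    zeros-then-w : map (bitSym decider) (replicate k false ++ w) ≡ replicate k 𝟙 ++ map (bitSym decider) w
    zeros-then-w = trans (map-++ (bitSym decider) (replicate k false) w)
                         (cong (_++ map (bitSym decider) w) (map-replicate (bitSym decider) k false))

  readBits-embed : ∀ a w′ w → readBits decider w′ ≡ readBits MA w → readBits decider (a ∷ w′) ≡ readBits MA (a ∷ w)
  readBits-embed 𝟘                w′ w _    = refl
  readBits-embed 𝟙                w′ w same = cong (false ∷_) same
  readBits-embed 𝟚                w′ w same = cong (true ∷_) same
  readBits-embed (fs (fs (fs _))) w′ w _    = refl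

  copy-finishes : ∀ b v {c′ c} → Sim._≈_ b c′ c → Config.state c ≡ haltA → output MA c ≡ v ∷ [] →
                  Config.state (step decider c′) ≡ HALT × output decider (step decider c′) ≡ (b xor v) ∷ []
  copy-finishes b v {cfg _ l′ _ r′} {cfg _ _ h r} (refl , refl , _ , r≈) refl out
    with Machine.readBits≡[_] MA v out
  ... | refl , r-empty
    rewrite step-S (copy b haltA) (bitSym MA v) l′ r′ (copy-running b haltA)
                   (trans (δ-copy-halted b _) (cong (λ s → HALT , s , S) (flipIf-bitSym b v)))
    = refl , readBits-bitSym (b xor v) (trans (Sim.readBits-≈ᵗ b readBits-embed r≈) r-empty)

module _ {A : Lang} {MA : TM} {cA : ℕ}
         (MA-decides : ∀ y → ComputesWithin MA (length y ^ cA + cA) y (A y ∷ [])) where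
  open DeciderMachine MA
  open Machine decider

  DecidesBalanced : Str → Set
  DecidesBalanced z = ComputesWithin decider (length z ^ (2 + cA) + (cA + 3)) z (balanced A z ∷ [])

  decider-zeros : ∀ b k → DecidesBalanced (b ∷ replicate k false ++ [])
  decider-zeros b k = computesWithin-run z (≤-trans time (n+n^c+[c+2]≤n^[2+c]+[c+3] (length z) cA))
    (run-seq (1 + k) 1 {c = initConfig decider z} (skip-zeros b k [])
       (step-S (skipping b) 𝟘 (replicate k 𝟘 ++ 𝟘 ∷ []) [] (skipping-running b) (skip-δ-end b)))
    refl
    (trans (readBits-bitSym (b xor true) refl) (cong (λ v → (b xor v) ∷ []) (sym (padded-zeros-++ A k []))))
    where
    z : Str
    z = b ∷ replicate k false ++ []
    ∣z∣ : length z ≡ suc k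
    ∣z∣ = cong suc (trans (length-++ (replicate k false)) (trans (+-identityʳ _) (length-replicate k)))
    time : (1 + k) + 1 ≤ length z + length z ^ cA + (cA + 2)
    time = +-mono-≤ (≤-trans (≤-reflexive (sym ∣z∣)) (m≤m+n (length z) _)) (≤-trans (s≤s z≤n) (m≤n+m 2 cA))

  module _ (b : Bool) (k : ℕ) (y : Str) where
    private
      module S = Sim b
      z : Str
      z = b ∷ replicate k false ++ true ∷ y
      c₀ : Config decider
      c₀ = cfgʳ (copy b (TM.start MA)) (𝟘 ∷ replicate k 𝟘 ++ 𝟘 ∷ []) (map (bitSym decider) y)
      enter : run decider ((1 + k) + 1) (initConfig decider z) ≡ c₀
      enter = run-seq (1 + k) 1 {c = initConfig decider z} (skip-zeros b k (true ∷ y))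
                (step-R (skipping b) 𝟚 (replicate k 𝟘 ++ 𝟘 ∷ []) _ (skipping-running b) (skip-δ-1 b))
      c₀≈ : S._≈_ c₀ (initConfig MA y)
      c₀≈ = S.start-≈ embed-bit (S.blanks-≈ᵗ (suc k) (S.blank′∷ S.[])) y

    decider-one : DecidesBalanced (b ∷ replicate k false ++ true ∷ y)
    decider-one with S.simulate (length y ^ cA + cA) c₀ (initConfig MA y) c₀≈ (proj₁ (MA-decides y))
    ... | t₀ , t₀≤T , end≈ with copy-finishes b (A y) end≈ (proj₁ (MA-decides y)) (proj₂ (MA-decides y))
    ... | halted , out = computesWithin-run z (≤-trans time (n+n^c+[c+2]≤n^[2+c]+[c+3] (length z) cA))
      (run-seq ((1 + k) + 1) (t₀ + 1) {c = initConfig decider z} enter (run-+ t₀ 1 c₀))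
      halted
      (trans out (cong (λ v → (b xor v) ∷ []) (sym (padded-zeros-++ A k (true ∷ y)))))
      where
      ∣z∣ : length z ≡ suc (k + suc (length y))
      ∣z∣ = cong suc (trans (length-++ (replicate k false)) (cong (_+ suc (length y)) (length-replicate k {false})))
      Y : ℕ
      Y = length y
      Y≤∣z∣ : Y ≤ length z
      Y≤∣z∣ = ≤-trans (≤-trans (n≤1+n Y) (m≤n+m (suc Y) k)) (≤-trans (n≤1+n _) (≤-reflexive (sym ∣z∣)))
      time : (1 + k) + 1 + (t₀ + 1) ≤ length z + length z ^ cA + (cA + 2)
      time = begin
        (1 + k) + 1 + (t₀ + 1)                          ≤⟨ +-monoʳ-≤ ((1 + k) + 1) (+-monoˡ-≤ 1 t₀≤T) ⟩
        (1 + k) + 1 + ((Y ^ cA + cA) + 1)               ≤⟨ m≤m+n _ (suc Y) ⟩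
        (1 + k) + 1 + ((Y ^ cA + cA) + 1) + suc Y
          ≡⟨ solve 4 (λ k Y P c → ((con 1 :+ k) :+ con 1 :+ ((P :+ c) :+ con 1)) :+ (con 1 :+ Y)
                                  := (con 1 :+ (k :+ (con 1 :+ Y))) :+ P :+ (c :+ con 2)) refl k Y (Y ^ cA) cA ⟩
        suc (k + suc Y) + Y ^ cA + (cA + 2)
          ≤⟨ +-monoˡ-≤ (cA + 2) (+-mono-≤ (≤-reflexive (sym ∣z∣)) (^-monoˡ-≤ cA Y≤∣z∣)) ⟩
        length z + length z ^ cA + (cA + 2) ∎
        where open ≤-Reasoning

  decider-correct : ∀ z → DecidesBalanced z
  decider-correct [] = computesWithin-run [] {t = 1} (≤-trans (s≤s z≤n) (m≤n+m 3 cA)) refl refl refl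
  decider-correct (b ∷ u) with leading-zeros u
  ... | zeros k       = decider-zeros b k
  ... | zeros-one k y = decider-one b k y

-- The ranker

pattern prefix₀ = fz
pattern prefix₁ = fs fz
pattern prefix₂ = fs (fs fz)
pattern prefix₃ = fs (fs (fs fz))
pattern mark    = fs (fs (fs (fs fz)))
pattern scan    = fs (fs (fs (fs (fs fz))))
pattern erase   = fs (fs (fs (fs (fs (fs fz)))))
pattern return  = fs (fs (fs (fs (fs (fs (fs fz))))))
pattern done    = fs (fs (fs (fs (fs (fs (fs (fs fz)))))))

-- The ranker writes 001 in front of its input and runs MB. When MB halts on out 1 0ʲ, the ranker
-- marks the cell left of it, scans to its end, erases 0ʲ and the last 1, and walks back to the mark.
module RankerMachine (MB : TM) where
  open TM MB using () renaming (nQ to nB; g to gB; start to startB; halt to haltB; δ to δB)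

  State : Set
  State = Fin (9 + nB)

  Symbol : Set
  Symbol = Fin (3 + (gB + 1))

  own : Fin 9 → State
  own i = i ↑ˡ nB

  embed : Fin nB → State
  embed q = 9 ↑ʳ q

  embedSym : Sym MB → Symbol
  embedSym s = s ↑ˡ 1

  markSym : Symbol
  markSym = fs (fs (fs (gB ↑ʳ fz)))

  δown : Fin 9 → Symbol → State × Symbol × Move
  δown prefix₀ s = own prefix₁ , s , L
  δown prefix₁ _ = own prefix₂ , 𝟚 , L
  δown prefix₂ _ = own prefix₃ , 𝟙 , L
  δown prefix₃ _ = embed startB , 𝟙 , S
  δown mark    _ = own scan , markSym , R
  δown scan    𝟙 = own scan , 𝟙 , R
  δown scan    𝟚 = own scan , 𝟚 , R
  δown scan    s = own erase , s , L
  δown erase   𝟙 = own erase , 𝟘 , L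
  δown erase   𝟚 = own return , 𝟘 , L
  δown return  𝟙 = own return , 𝟙 , L
  δown return  𝟚 = own return , 𝟚 , L
  δown _       s = own done , s , R   -- return has reached the mark; the other cases are unreachable

  δembed : Fin nB → Symbol → State × Symbol × Move
  δembed q s = if does (q ≟ haltB) then (own mark , s , L) else
    [ (λ s′ → embed (proj₁ (δB q s′)) , embedSym (proj₁ (proj₂ (δB q s′))) , proj₂ (proj₂ (δB q s′)))
    , (λ _ → own done , s , S)
    ]′ (splitAt (3 + gB) s)

  δ : State → Symbol → State × Symbol × Move
  δ q s = [ (λ i → δown i s) , (λ q → δembed q s) ]′ (splitAt 9 q)

  ranker : TM
  ranker = record { nQ = 9 + nB ; g = gB + 1 ; start = own prefix₀ ; halt = own done ; δ = δ }

  δ-embed-running : ∀ q s → ¬ q ≡ haltB →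
    δ (embed q) (embedSym s) ≡ (embed (proj₁ (δB q s)) , embedSym (proj₁ (proj₂ (δB q s))) , proj₂ (proj₂ (δB q s)))
  δ-embed-running q s q≢halt rewrite dec-false (q ≟ haltB) q≢halt | splitAt-↑ˡ (3 + gB) s 1 = refl

  δ-embed-halted : ∀ s → δ (embed haltB) s ≡ (own mark , s , L)
  δ-embed-halted s rewrite dec-true (haltB ≟ haltB) refl = refl

  module Sim = Simulation MB ranker embed embedSym refl (λ q ()) δ-embed-running

  embed-bit : ∀ c → embedSym (bitSym MB c) ≡ bitSym ranker c
  embed-bit false = refl
  embed-bit true  = refl

  readBits-embed : ∀ a w′ w → readBits ranker w′ ≡ readBits MB w → readBits ranker (embedSym a ∷ w′) ≡ readBits MB (a ∷ w)
  readBits-embed 𝟘                w′ w _    = refl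
  readBits-embed 𝟙                w′ w same = cong (false ∷_) same
  readBits-embed 𝟚                w′ w same = cong (true ∷_) same
  readBits-embed (fs (fs (fs _))) w′ w _    = refl

  prefix-≈ : ∀ x → run ranker 4 (initConfig ranker x) Sim.≈ initConfig MB (false ∷ false ∷ true ∷ x)
  prefix-≈ []      = refl , refl , Sim.[] , _ Sim.∷ _ Sim.∷ Sim.blank′∷ Sim.[]
  prefix-≈ (c ∷ x) = refl , refl , Sim.[] , _ Sim.∷ _ Sim.∷ Sim.bits-≈ᵗ embed-bit (c ∷ x)

  open Machine ranker

  halted-to-mark : ∀ l h r → step ranker (cfg (embed haltB) l h r) ≡ cfgˡ (own mark) l (h ∷ r)
  halted-to-mark l h r = step-L (embed haltB) h l r (λ ()) (δ-embed-halted h)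

  mark-left : ∀ l w → step ranker (cfgˡ (own mark) l w) ≡ cfgʳ (own scan) (markSym ∷ drop 1 l) w
  mark-left []      w = step-R (own mark) 𝟘 [] w (λ ()) refl
  mark-left (a ∷ l) w = step-R (own mark) a l w (λ ()) refl

  scan-digits : ∀ d l r → run ranker (length d) (cfgʳ (own scan) l (map (bitSym ranker) d ++ r))
                          ≡ cfgʳ (own scan) (map (bitSym ranker) d ʳ++ l) r
  scan-digits d l r = sweep-R-bits d l r (λ ()) λ { false → refl ; true → refl }

  scan-end : ∀ l r → readBits ranker r ≡ [] → Σ (List Symbol) λ ρ → step ranker (cfgʳ (own scan) l r) ≡ cfgˡ (own erase) l ρ
  scan-end l []                    _ = 𝟘 ∷ [] , step-L (own scan) 𝟘 l [] (λ ()) refl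
  scan-end l (𝟘 ∷ r)               _ = 𝟘 ∷ r , step-L (own scan) 𝟘 l r (λ ()) refl
  scan-end l (a@(fs (fs (fs _))) ∷ r) _ = a ∷ r , step-L (own scan) a l r (λ ()) refl
  scan-end l (𝟙 ∷ r) ()
  scan-end l (𝟚 ∷ r) ()

  erase-top : ∀ j l ρ → run ranker (j + 1) (cfgˡ (own erase) (replicate j 𝟙 ++ 𝟚 ∷ l) ρ)
                        ≡ cfgˡ (own return) l (𝟘 ∷ replicate j 𝟘 ++ ρ)
  erase-top j l ρ = run-seq j 1 (sweep-L-replicate j 𝟙 (𝟚 ∷ l) ρ (λ ()) refl)
                                (step-L (own erase) 𝟚 l (replicate j 𝟘 ++ ρ) (λ ()) refl)

  return-to-mark : ∀ out l ρ → run ranker (length out + 1) (cfgˡ (own return) (map (bitSym ranker) out ʳ++ markSym ∷ l) ρ)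
                               ≡ cfgʳ (own done) (markSym ∷ l) (map (bitSym ranker) out ++ ρ)
  return-to-mark out l ρ = run-seq (length out) 1 (sweep-L-bits out (markSym ∷ l) ρ (λ ()) λ { false → refl ; true → refl })
                                                  (step-R (own return) markSym l _ (λ ()) refl)

  digits-reversed : ∀ out j l → map (bitSym ranker) (out ++ true ∷ replicate j false) ʳ++ l
                                ≡ replicate j 𝟙 ++ 𝟚 ∷ map (bitSym ranker) out ʳ++ l
  digits-reversed out j l = begin
    map bit (out ++ true ∷ replicate j false) ʳ++ l             ≡⟨ cong (_ʳ++ l) (map-++ bit out (true ∷ replicate j false)) ⟩
    (map bit out ++ 𝟚 ∷ map bit (replicate j false)) ʳ++ l      ≡⟨ ++-ʳ++ (map bit out) ⟩
    map bit (replicate j false) ʳ++ 𝟚 ∷ map bit out ʳ++ l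
      ≡⟨ cong (_ʳ++ (𝟚 ∷ map bit out ʳ++ l)) (map-replicate bit j false) ⟩
    replicate j 𝟙 ʳ++ 𝟚 ∷ map bit out ʳ++ l                     ≡⟨ replicate-ʳ++ j 𝟙 _ ⟩
    replicate j 𝟙 ++ 𝟚 ∷ map bit out ʳ++ l ∎
    where open ≡-Reasoning
          bit : Bool → Symbol
          bit = bitSym ranker

  readBits-bits : ∀ out ρ → readBits ranker (map (bitSym ranker) out ++ 𝟘 ∷ ρ) ≡ out
  readBits-bits []          ρ = refl
  readBits-bits (false ∷ out) ρ = cong (false ∷_) (readBits-bits out ρ)
  readBits-bits (true ∷ out)  ρ = cong (true ∷_) (readBits-bits out ρ)

  post-process : ∀ c out j rest → Config.state c ≡ embed haltB →
                 Config.head c ∷ Config.right c ≡ map (bitSym ranker) (out ++ true ∷ replicate j false) ++ rest →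
                 readBits ranker rest ≡ [] →
                 HaltsWithin (2 * (length out + suc j) + 4) c out
  post-process (cfg _ l h r) out j rest refl w≡ rest-empty
    with scan-end (map (bitSym ranker) (out ++ true ∷ replicate j false) ʳ++ markSym ∷ drop 1 l) rest rest-empty
  ... | ρ , turn = haltsWithin-mono {c = cfg (embed haltB) l h r} time
    (haltsWithin-after 1 (halted-to-mark l h r)
    (haltsWithin-after 1 (trans (mark-left l (h ∷ r)) (cong (cfgʳ (own scan) (markSym ∷ drop 1 l)) w≡))
    (haltsWithin-after (length d) (scan-digits d (markSym ∷ drop 1 l) rest)
    (haltsWithin-after 1 turn
    (haltsWithin-after (j + 1) (trans (cong (λ W → run ranker (j + 1) (cfgˡ (own erase) W ρ)) (digits-reversed out j _))
                                      (erase-top j _ ρ))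
    (haltsWithin-after (length out + 1) (return-to-mark out (drop 1 l) _)
    (halted-cfgʳ (readBits-bits out _))))))))
    where
    d : Str
    d = out ++ true ∷ replicate j false
    time : 1 + (1 + (length d + (1 + ((j + 1) + ((length out + 1) + 0))))) ≤ 2 * (length out + suc j) + 4
    time = ≤-reflexive (begin
      1 + (1 + (length d + (1 + ((j + 1) + ((length out + 1) + 0)))))
        ≡⟨ cong (λ k → 1 + (1 + (k + (1 + ((j + 1) + ((length out + 1) + 0)))))) ∣d∣ ⟩
      1 + (1 + ((length out + suc j) + (1 + ((j + 1) + ((length out + 1) + 0)))))
        ≡⟨ solve 2 (λ a j → con 1 :+ (con 1 :+ ((a :+ (con 1 :+ j)) :+ (con 1 :+ ((j :+ con 1) :+ ((a :+ con 1) :+ con 0)))))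
                           := con 2 :* (a :+ (con 1 :+ j)) :+ con 4) refl (length out) j ⟩
      2 * (length out + suc j) + 4 ∎)
      where open ≡-Reasoning
            ∣d∣ : length d ≡ length out + suc j
            ∣d∣ = trans (length-++ out) (cong (λ k → length out + suc k) (length-replicate j))

rankerDegree : ℕ → ℕ
rankerDegree c = (4 + 2 * c) + (6 ^ c + c + 14)

ranker-time-bound : ∀ n c → 4 + (((3 + n) ^ c + c) + (2 * (2 + n) + 4)) ≤ n ^ rankerDegree c + rankerDegree c
ranker-time-bound n c = begin
  4 + (((3 + n) ^ c + c) + (2 * (2 + n) + 4))        ≤⟨ +-monoʳ-≤ 4 (+-monoˡ-≤ _ (+-monoˡ-≤ c ([3+n]^c≤n^[2c]+6^c n c))) ⟩
  4 + (((n ^ (2 * c) + 6 ^ c) + c) + (2 * (2 + n) + 4))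
    ≡⟨ solve 4 (λ n P S c → con 4 :+ (((P :+ S) :+ c) :+ (con 2 :* (con 2 :+ n) :+ con 4))
                            := (n :+ (n :+ P)) :+ (S :+ c :+ con 12)) refl n (n ^ (2 * c)) (6 ^ c) c ⟩
  (n + (n + n ^ (2 * c))) + (6 ^ c + c + 12)          ≤⟨ +-monoˡ-≤ _ (+-monoʳ-≤ n (n+n^c≤n^[2+c]+1 n (2 * c))) ⟩
  (n + (n ^ (2 + 2 * c) + 1)) + (6 ^ c + c + 12)      ≡⟨ cong (_+ (6 ^ c + c + 12)) (+-assoc n _ 1) ⟨
  (n + n ^ (2 + 2 * c) + 1) + (6 ^ c + c + 12)        ≤⟨ +-monoˡ-≤ _ (+-monoˡ-≤ 1 (n+n^c≤n^[2+c]+1 n (2 + 2 * c))) ⟩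
  (n ^ (4 + 2 * c) + 1 + 1) + (6 ^ c + c + 12)
    ≡⟨ solve 3 (λ X S c → ((X :+ con 1) :+ con 1) :+ (S :+ c :+ con 12) := X :+ (S :+ c :+ con 14)) refl (n ^ (4 + 2 * c)) (6 ^ c) c ⟩
  n ^ (4 + 2 * c) + (6 ^ c + c + 14)
    ≤⟨ +-mono-≤ (^-monoʳ-≤⁺ n (s≤s z≤n) (m≤m+n (4 + 2 * c) (6 ^ c + c + 14))) (m≤n+m _ (4 + 2 * c)) ⟩
  n ^ rankerDegree c + rankerDegree c ∎
  where open ≤-Reasoning

module _ (A : Lang) (MB : TM) (cB : ℕ)
         (MB-ranks : ∀ z → ComputesWithin MB (length z ^ cB + cB) z (encℕ (rank (balanced A) z))) where
  open RankerMachine MB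
  open Machine ranker

  module _ (x : Str) where
    private
      n r : ℕ
      n = length x
      r = rank A x
      z : Str
      z = false ∷ false ∷ true ∷ x
      c₀ : Config ranker
      c₀ = run ranker 4 (initConfig ranker x)

    ranker-correct : ComputesWithin ranker (n ^ rankerDegree cB + rankerDegree cB) x (encℕ r)
    ranker-correct
      with Sim.simulate (length z ^ cB + cB) c₀ (initConfig MB z) (prefix-≈ x) (proj₁ (MB-ranks z))
         | encℕ-2^+ (2 + n) r (≤-<-trans (rank-< A x) (^-monoʳ-< 2 (s≤s (s≤s z≤n)) (n<1+n (suc n))))
    ... | t₀ , t₀≤T , cf′≈cf | j , d≡ , ∣d∣
      with readBits-split (Config.head (run ranker t₀ c₀) ∷ Config.right (run ranker t₀ c₀))
    ... | rest , w≡ , rest-empty =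
      computesWithin (haltsWithin-mono time (haltsWithin-after 4 refl (haltsWithin-after t₀ refl
        (post-process cf′ (encℕ r) j rest halted (trans w≡ (cong (λ d → map (bitSym ranker) d ++ rest) out)) rest-empty))))
      where
      cf′ : Config ranker
      cf′ = run ranker t₀ c₀
      halted : Config.state cf′ ≡ embed (TM.halt MB)
      halted = trans (proj₁ cf′≈cf) (cong embed (proj₁ (MB-ranks z)))
      out : output ranker cf′ ≡ encℕ r ++ true ∷ replicate j false
      out = begin
        output ranker cf′                                          ≡⟨ Sim.output-≈ readBits-embed cf′ _ cf′≈cf ⟩
        output MB (run MB (length z ^ cB + cB) (initConfig MB z))   ≡⟨ proj₂ (MB-ranks z) ⟩
        encℕ (rank (balanced A) z)                                 ≡⟨ cong encℕ (rank-balanced A x) ⟩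
        encℕ (2 ^ (2 + n) + r)                                     ≡⟨ d≡ ⟩
        encℕ r ++ true ∷ replicate j false ∎
        where open ≡-Reasoning
      time : 4 + (t₀ + (2 * (length (encℕ r) + suc j) + 4)) ≤ n ^ rankerDegree cB + rankerDegree cB
      time = ≤-trans (+-monoʳ-≤ 4 (+-mono-≤ t₀≤T (≤-reflexive (cong (λ k → 2 * k + 4) ∣d∣)))) (ranker-time-bound n cB)

balanced-inP : ∀ A → InP A → InP (balanced A)
balanced-inP A (MA , cA , MA-decides) = decider , cA + 3 , λ z →
  computesWithin-mono (+-monoˡ-≤ (cA + 3) (^-monoʳ-≤⁺ (length z) (s≤s z≤n) 2+cA≤cA+3)) (decider-correct MA-decides z)
  where
  open DeciderMachine MA
  open Machine decider
  2+cA≤cA+3 : 2 + cA ≤ cA + 3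
  2+cA≤cA+3 = ≤-trans (n≤1+n (2 + cA)) (≤-reflexive (+-comm 3 cA))

balanced-census : ∀ A → CensusPolyTime (balanced A)
balanced-census A = censusMachine , 2 , λ N →
  subst (λ v → ComputesWithin censusMachine (N ^ 2 + 2) (replicate N true) (encℕ v))
        (sym (census-balanced A N)) (census-machine-correct N)

rankable-balanced⇒rankable : ∀ A → Rankable (balanced A) → Rankable A
rankable-balanced⇒rankable A (MB , cB , MB-ranks) = ranker , rankerDegree cB , ranker-correct A MB cB MB-ranks
  where open RankerMachine MB

corollary3p3 : ((A : Lang) → InP A → Rankable A)
    ⇔ ((A : Lang) → InP A → CensusPolyTime A → Rankable A)
corollary3p3 = mk⇔ (λ P-rankable A A∈P _ → P-rankable A A∈P)
                   (λ P∩census-rankable A A∈P → rankable-balanced⇒rankable A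
                      (P∩census-rankable (balanced A) (balanced-inP A A∈P) (balanced-census A)))
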